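{- For every integer $m \geq 9$, the independence polynomial of the tree $(T_{1,2}^v:S_{2,4}^w)_2^{(m)}$ has degree $10m+3$, and its log-concavity is broken at index $10m+2$.
   Context: $I(G;x)=\sum_i s_ix^i$ with $s_i$ the number of independent sets of size $i$. Log-concavity of $I(G;x)$ is broken at index $i$ if $s_i^2 < s_{i-1}s_{i+1}$. For a rooted graph $H^w$ and $k\ge0$, $Z_k(H^w)$ is a new vertex $v_0$ joined to the roots of $k$ disjoint copies of $H$; $(G^v:H^w)_k$ is the disjoint union of $G$ and $Z_k(H^w)$ plus the edge $vv_0$, rooted at $v$; $(G^v:H^w)_k^{(m)}$ is obtained by applying this construction $m$ times, each time to the previous graph (still rooted at $v$). $P_t^w$ is the path on $t$ vertices rooted at a leaf. $T_{1,\ell}^v=(P_1^v:P_2^w)_\ell$: a root $v$ with one child carrying $\ell$ pendant 2-vertex paths. $S_{2,t}^w$ is the spider with $t$ legs of length 2 rooted at its center $w$ (equivalently $(P_1^w:P_1^w)_1^{(t)}$). -}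

module Defs where

open import Data.Nat using (ℕ; zero; suc; _+_; _*_; _≡ᵇ_)
open import Data.Bool using (Bool; true; false; _∧_; not; if_then_else_)
open import Data.List using (List; []; _∷_; _∷ʳ_; replicate; length; filterᵇ; map; concatMap)

-- Finite rooted trees: the root with the list of subtrees hanging from its children.
-- Vertices are the nodes; edges are exactly the parent–child pairs.
data Tree : Set where
  node : List Tree → Tree

-- A vertex subset of a tree: the same shape, each vertex labelled in/out.
data LTree : Set where
  lnode : Bool → List LTree → LTree

mutual
  subsets : Tree → List LTree
  subsets (node cs) = concatMap (λ b → map (lnode b) (subsetsF cs)) (true ∷ false ∷ [])

  subsetsF : List Tree → List (List LTree)
  subsetsF [] = [] ∷ []
  subsetsF (t ∷ ts) = concatMap (λ l → map (l ∷_) (subsetsF ts)) (subsets t)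

rootIn : LTree → Bool
rootIn (lnode b _) = b

mutual
  independent : LTree → Bool
  independent (lnode b cs) = (if b then noRootIn cs else true) ∧ independentF cs

  independentF : List LTree → Bool
  independentF [] = true
  independentF (c ∷ cs) = independent c ∧ independentF cs

  noRootIn : List LTree → Bool
  noRootIn [] = true
  noRootIn (c ∷ cs) = not (rootIn c) ∧ noRootIn cs

mutual
  size : LTree → ℕ
  size (lnode b cs) = (if b then 1 else 0) + sizeF cs

  sizeF : List LTree → ℕ
  sizeF [] = 0
  sizeF (c ∷ cs) = size c + sizeF cs

indepCoeff : Tree → ℕ → ℕ
indepCoeff G i = length (filterᵇ (λ S → independent S ∧ (size S ≡ᵇ i)) (subsets G))

P₁ : Tree
P₁ = node []

P₂ : Tree
P₂ = node (P₁ ∷ [])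

Z : ℕ → Tree → Tree
Z k H = node (replicate k H)

-- (G^v : H^w)_k : add edge v v₀ to G ⊔ Z_k(H^w), rooted at v
attach : Tree → Tree → ℕ → Tree
attach (node cs) H k = node (cs ∷ʳ Z k H)

attachIter : Tree → Tree → ℕ → ℕ → Tree
attachIter G H k zero = G
attachIter G H k (suc m) = attach (attachIter G H k m) H k

T₁ : ℕ → Tree
T₁ ℓ = attach P₁ P₂ ℓ

S₂ : ℕ → Tree
S₂ t = attachIter P₁ P₁ 1 t

{-# OPTIONS --safe #-}
-- Counting independent sets by whether they contain the root v gives I(T) = I(T − v) + x·I(T − N[v]),
-- and both terms are products over the subtrees hanging from v. The root of G m has the children of
-- G 0 and m further copies of branch = Z 2 (S₂ 4), so I(G m − v) and I(G m − N[v]) are fixed polynomials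
-- multiplied m times by P = I(branch) and Q = I(branch − root), both of degree 10 with leading
-- coefficient 1. Reading the three top coefficients off these powers, x^(10m+3), x^(10m+2), x^(10m+1)
-- in I(G m) have coefficients 5, 10 + 456m and 6 + 5340m + 94016·C(m,2), and
-- (10 + 456m)² < 5·(6 + 5340m + 94016·C(m,2)) once m ≥ 9.
module Submission where

open import Defs
open import Data.Nat using (ℕ; _+_; _*_; _≥_; _>_; _<_)
open import Data.Product using (_×_)
open import Relation.Binary.PropositionalEquality using (_≡_; _≢_)

open import Data.Nat using (zero; suc; _∸_; _⊔_; _≤_; _≤?_; _<?_; _≡ᵇ_; z≤n; s≤s)
open import Data.Nat.Properties
open import Data.Nat.Combinatorics using (_C_; nC1≡n; nCk+nC[k+1]≡[n+1]C[k+1])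
open import Data.Nat.Tactic.RingSolver using (solve-∀)
open import Data.Bool using (Bool; true; false; _∧_; not; if_then_else_)
open import Data.Bool.Properties using (∧-zeroʳ; ∧-commutativeMonoid; T-≡)
open import Function.Bundles using (Equivalence)
open import Data.List using (List; []; _∷_; _∷ʳ_; _++_; map; concatMap; filterᵇ; length)
open import Data.Bool.ListAction using (all)
open import Data.Product using (_,_)
open import Data.Unit using (tt)
open import Data.Sum using (inj₁; inj₂)
open import Relation.Nullary using (yes; no; contradiction)
open import Relation.Binary.PropositionalEquality
  using (refl; sym; trans; cong; cong₂; subst; subst₂; _≗_; module ≡-Reasoning)
open import Algebra.Bundles using (CommutativeMonoid)
import Algebra.Properties.CommutativeSemigroup as CommutativeSemigroupProperties

module ℕ+ = CommutativeSemigroupProperties +-commutativeSemigroup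
module 𝔹∧ = CommutativeSemigroupProperties (CommutativeMonoid.commutativeSemigroup ∧-commutativeMonoid)

open ≡-Reasoning

private
  variable
    A B : Set

∑ : List A → (A → ℕ) → ℕ
∑ [] f = 0
∑ (x ∷ xs) f = f x + ∑ xs f

infix 5 ∑
syntax ∑ xs (λ x → e) = ∑[ x ∈ xs ] e

∑-cong : ∀ (xs : List A) {f g : A → ℕ} → f ≗ g → ∑ xs f ≡ ∑ xs g
∑-cong []       f≗g = refl
∑-cong (x ∷ xs) f≗g = cong₂ _+_ (f≗g x) (∑-cong xs f≗g)

∑-zero : ∀ (xs : List A) {f : A → ℕ} → (∀ x → f x ≡ 0) → ∑ xs f ≡ 0
∑-zero []       f≡0 = refl
∑-zero (x ∷ xs) f≡0 = cong₂ _+_ (f≡0 x) (∑-zero xs f≡0)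

∑-++ : ∀ (xs ys : List A) f → ∑ (xs ++ ys) f ≡ ∑ xs f + ∑ ys f
∑-++ []       ys f = refl
∑-++ (x ∷ xs) ys f = trans (cong (f x +_) (∑-++ xs ys f)) (sym (+-assoc (f x) _ _))

∑-+ : ∀ (xs : List A) f g → ∑[ x ∈ xs ] (f x + g x) ≡ ∑ xs f + ∑ xs g
∑-+ []       f g = refl
∑-+ (x ∷ xs) f g = trans (cong (f x + g x +_) (∑-+ xs f g)) (ℕ+.interchange (f x) (g x) _ _)

∑-map : ∀ (h : A → B) xs f → ∑ (map h xs) f ≡ ∑[ x ∈ xs ] f (h x)
∑-map h []       f = refl
∑-map h (x ∷ xs) f = cong (f (h x) +_) (∑-map h xs f)

∑-concatMap : ∀ (h : A → List B) xs f → ∑ (concatMap h xs) f ≡ ∑[ x ∈ xs ] ∑ (h x) f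
∑-concatMap h []       f = refl
∑-concatMap h (x ∷ xs) f =
  trans (∑-++ (h x) (concatMap h xs) f) (cong (∑ (h x) f +_) (∑-concatMap h xs f))

∑-comm : ∀ (xs : List A) (ys : List B) (F : A → B → ℕ) →
  ∑[ x ∈ xs ] ∑[ y ∈ ys ] F x y ≡ ∑[ y ∈ ys ] ∑[ x ∈ xs ] F x y
∑-comm []       ys F = sym (∑-zero ys (λ _ → refl))
∑-comm (x ∷ xs) ys F = trans (cong (∑ ys (F x) +_) (∑-comm xs ys F)) (sym (∑-+ ys (F x) _))

𝟙 : Bool → ℕ
𝟙 b = if b then 1 else 0

length-filterᵇ : ∀ (q : A → Bool) xs → length (filterᵇ q xs) ≡ ∑[ x ∈ xs ] 𝟙 (q x)
length-filterᵇ q [] = refl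
length-filterᵇ q (x ∷ xs) with q x
... | true  = cong suc (length-filterᵇ q xs)
... | false = length-filterᵇ q xs

∑< : ℕ → (ℕ → ℕ) → ℕ
∑< zero    f = 0
∑< (suc n) f = ∑< n f + f n

infix 5 ∑<
syntax ∑< n (λ j → e) = ∑[ j < n ] e

∑<-cong : ∀ n {f g : ℕ → ℕ} → (∀ j → j < n → f j ≡ g j) → ∑< n f ≡ ∑< n g
∑<-cong zero    f≡g = refl
∑<-cong (suc n) f≡g = cong₂ _+_ (∑<-cong n (λ j j<n → f≡g j (m<n⇒m<1+n j<n))) (f≡g n (n<1+n n))

∑<-zero : ∀ n {f : ℕ → ℕ} → (∀ j → j < n → f j ≡ 0) → ∑< n f ≡ 0
∑<-zero zero    f≡0 = refl
∑<-zero (suc n) f≡0 = cong₂ _+_ (∑<-zero n (λ j j<n → f≡0 j (m<n⇒m<1+n j<n))) (f≡0 n (n<1+n n))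

∑<-+ : ∀ n f g → ∑[ j < n ] (f j + g j) ≡ ∑< n f + ∑< n g
∑<-+ zero    f g = refl
∑<-+ (suc n) f g = trans (cong (_+ (f n + g n)) (∑<-+ n f g)) (ℕ+.interchange (∑< n f) (∑< n g) (f n) (g n))

∑<-split : ∀ a b h → ∑< (a + b) h ≡ ∑< a h + (∑[ t < b ] h (a + t))
∑<-split a zero    h = trans (cong (λ n → ∑< n h) (+-identityʳ a)) (sym (+-identityʳ _))
∑<-split a (suc b) h = begin
  ∑< (a + suc b) h                              ≡⟨ cong (λ n → ∑< n h) (+-suc a b) ⟩
  ∑< (a + b) h + h (a + b)                      ≡⟨ cong (_+ h (a + b)) (∑<-split a b h) ⟩
  ∑< a h + (∑[ t < b ] h (a + t)) + h (a + b)   ≡⟨ +-assoc (∑< a h) _ _ ⟩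
  ∑< a h + (∑[ t < suc b ] h (a + t))           ∎

-- Polynomials are their coefficient functions ℕ → ℕ: conv is the product, shift is multiplication by x.
conv : (ℕ → ℕ) → (ℕ → ℕ) → ℕ → ℕ
conv f g i = ∑[ j < suc i ] f j * g (i ∸ j)

conv-cong : ∀ {f f′ g g′ : ℕ → ℕ} → f ≗ f′ → g ≗ g′ → conv f g ≗ conv f′ g′
conv-cong f≗f′ g≗g′ i = ∑<-cong (suc i) (λ j _ → cong₂ _*_ (f≗f′ j) (g≗g′ (i ∸ j)))

one : ℕ → ℕ
one zero    = 1
one (suc i) = 0

shift : (ℕ → ℕ) → ℕ → ℕ
shift f zero    = 0
shift f (suc i) = f i

shift-cong : ∀ {f g : ℕ → ℕ} → f ≗ g → shift f ≗ shift g
shift-cong f≗g zero    = refl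
shift-cong f≗g (suc i) = f≗g i

shiftBy : ℕ → (ℕ → ℕ) → ℕ → ℕ
shiftBy zero    f = f
shiftBy (suc s) f = shift (shiftBy s f)

shiftBy-below : ∀ s f {i} → i < s → shiftBy s f i ≡ 0
shiftBy-below (suc s) f {zero}  _   = refl
shiftBy-below (suc s) f {suc i} i<s = shiftBy-below s f (≤-pred i<s)

shiftBy-above : ∀ s f {i} → s ≤ i → shiftBy s f i ≡ f (i ∸ s)
shiftBy-above zero    f {i}     _   = refl
shiftBy-above (suc s) f {suc i} s≤i = shiftBy-above s f (≤-pred s≤i)

≡ᵇ-refl : ∀ n → (n ≡ᵇ n) ≡ true
≡ᵇ-refl n = Equivalence.to T-≡ (≡⇒≡ᵇ n n refl)

≢⇒≡ᵇ-false : ∀ {m n} → m ≢ n → (m ≡ᵇ n) ≡ false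
≢⇒≡ᵇ-false {m} {n} m≢n with m ≡ᵇ n | ≡ᵇ⇒≡ m n
... | true  | ≡ᵇ⇒m≡n = contradiction (≡ᵇ⇒m≡n _) m≢n
... | false | _       = refl

∑-δ-beyond : ∀ s n (h : ℕ → ℕ) → n ≤ s → ∑[ j < n ] 𝟙 (s ≡ᵇ j) * h j ≡ 0
∑-δ-beyond s n h n≤s =
  ∑<-zero n (λ j j<n → cong (λ b → 𝟙 b * h j) (≢⇒≡ᵇ-false (>⇒≢ (<-≤-trans j<n n≤s))))

∑-δ : ∀ s n (h : ℕ → ℕ) → s < n → ∑[ j < n ] 𝟙 (s ≡ᵇ j) * h j ≡ h s
∑-δ s (suc n) h s<1+n with m≤n⇒m<n∨m≡n (≤-pred s<1+n)
... | inj₁ s<n  = trans (cong₂ _+_ (∑-δ s n h s<n) (cong (λ b → 𝟙 b * h n) (≢⇒≡ᵇ-false (<⇒≢ s<n))))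
                        (+-identityʳ (h s))
... | inj₂ refl = trans (cong₂ _+_ (∑-δ-beyond s s h ≤-refl) (cong (λ b → 𝟙 b * h s) (≡ᵇ-refl s)))
                        (+-identityʳ (h s))

∑-indicator : ∀ b s (H : ℕ → ℕ) i → (∀ j → i < j → H j ≡ 0) →
  ∑[ j < suc i ] 𝟙 (b ∧ (s ≡ᵇ j)) * H j ≡ 𝟙 b * H s
∑-indicator false s H i H≡0 = ∑<-zero (suc i) (λ _ _ → refl)
∑-indicator true  s H i H≡0 with s ≤? i
... | yes s≤i = trans (∑-δ s (suc i) H (s≤s s≤i)) (sym (+-identityʳ (H s)))
... | no  s≰i = trans (∑-δ-beyond s (suc i) H (≰⇒> s≰i)) (sym (cong (_+ 0) (H≡0 s (≰⇒> s≰i))))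

countBy : (A → Bool) → (A → ℕ) → List A → ℕ → ℕ
countBy q sz E i = ∑[ e ∈ E ] 𝟙 (q e ∧ (sz e ≡ᵇ i))

∑-fibres : ∀ (E : List A) q sz (H : ℕ → ℕ) i → (∀ j → i < j → H j ≡ 0) →
  ∑[ e ∈ E ] 𝟙 (q e) * H (sz e) ≡ ∑[ j < suc i ] countBy q sz E j * H j
∑-fibres []      q sz H i H≡0 = sym (∑<-zero (suc i) (λ _ _ → refl))
∑-fibres (x ∷ E) q sz H i H≡0 = begin
  𝟙 (q x) * H (sz x) + (∑[ e ∈ E ] 𝟙 (q e) * H (sz e))
    ≡⟨ cong₂ _+_ (sym (∑-indicator (q x) (sz x) H i H≡0)) (∑-fibres E q sz H i H≡0) ⟩
  (∑[ j < suc i ] 𝟙 (q x ∧ (sz x ≡ᵇ j)) * H j) + (∑[ j < suc i ] countBy q sz E j * H j)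
    ≡⟨ sym (∑<-+ (suc i) _ _) ⟩
  ∑[ j < suc i ] (𝟙 (q x ∧ (sz x ≡ᵇ j)) * H j + countBy q sz E j * H j)
    ≡⟨ ∑<-cong (suc i) (λ j _ → sym (*-distribʳ-+ (H j) (𝟙 (q x ∧ (sz x ≡ᵇ j))) _)) ⟩
  ∑[ j < suc i ] countBy q sz (x ∷ E) j * H j ∎

countBy-shift : ∀ (E : List A) q sz s i → countBy q (λ e → s + sz e) E i ≡ shiftBy s (countBy q sz E) i
countBy-shift E q sz zero    i       = refl
countBy-shift E q sz (suc s) zero    = ∑-zero E (λ e → cong 𝟙 (∧-zeroʳ (q e)))
countBy-shift E q sz (suc s) (suc i) = countBy-shift E q sz s i

count : (LTree → Bool) → Tree → ℕ → ℕ
count p t = countBy p size (subsets t)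

countF : (LTree → Bool) → List Tree → ℕ → ℕ
countF p ts = countBy (all p) sizeF (subsetsF ts)

avoidsRoot : LTree → Bool
avoidsRoot S = not (rootIn S) ∧ independent S

∑-subsets : ∀ ts (f : LTree → ℕ) →
  ∑ (subsets (node ts)) f
    ≡ (∑[ Ss ∈ subsetsF ts ] f (lnode true Ss)) + (∑[ Ss ∈ subsetsF ts ] f (lnode false Ss))
∑-subsets ts f = trans (∑-concatMap (λ b → map (lnode b) (subsetsF ts)) (true ∷ false ∷ []) f)
  (cong₂ _+_ (∑-map (lnode true) (subsetsF ts) f)
             (trans (+-identityʳ _) (∑-map (lnode false) (subsetsF ts) f)))

∑-subsetsF : ∀ t ts (f : List LTree → ℕ) →
  ∑ (subsetsF (t ∷ ts)) f ≡ ∑[ S ∈ subsets t ] ∑[ Ss ∈ subsetsF ts ] f (S ∷ Ss)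
∑-subsetsF t ts f = trans (∑-concatMap (λ S → map (S ∷_) (subsetsF ts)) (subsets t) f)
  (∑-cong (subsets t) (λ S → ∑-map (S ∷_) (subsetsF ts) f))

countF-[] : ∀ p → countF p [] ≗ one
countF-[] p zero    = refl
countF-[] p (suc i) = refl

countF-∷ : ∀ p t ts → countF p (t ∷ ts) ≗ conv (count p t) (countF p ts)
countF-∷ p t ts i = begin
  countF p (t ∷ ts) i
    ≡⟨ ∑-subsetsF t ts _ ⟩
  ∑[ S ∈ subsets t ] countBy (λ Ss → p S ∧ all p Ss) (λ Ss → size S + sizeF Ss) (subsetsF ts) i
    ≡⟨ ∑-cong (subsets t) count-with-first ⟩
  ∑[ S ∈ subsets t ] 𝟙 (p S) * shiftBy (size S) (countF p ts) i
    ≡⟨ ∑-fibres (subsets t) p size (λ j → shiftBy j (countF p ts) i) i (λ j i<j → shiftBy-below j _ i<j) ⟩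
  ∑[ j < suc i ] count p t j * shiftBy j (countF p ts) i
    ≡⟨ ∑<-cong (suc i) (λ j j≤i → cong (count p t j *_) (shiftBy-above j _ (≤-pred j≤i))) ⟩
  conv (count p t) (countF p ts) i ∎
  where
  count-with-first : ∀ S → countBy (λ Ss → p S ∧ all p Ss) (λ Ss → size S + sizeF Ss) (subsetsF ts) i
                         ≡ 𝟙 (p S) * shiftBy (size S) (countF p ts) i
  count-with-first S with p S
  ... | true  = trans (countBy-shift (subsetsF ts) (all p) sizeF (size S) i) (sym (+-identityʳ _))
  ... | false = ∑-zero (subsetsF ts) (λ _ → refl)

countF-swap : ∀ p t u ts → countF p (t ∷ u ∷ ts) ≗ countF p (u ∷ t ∷ ts)
countF-swap p t u ts i = begin
  countF p (t ∷ u ∷ ts) i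
    ≡⟨ ∑-subsetsF t (u ∷ ts) φ ⟩
  ∑[ S ∈ subsets t ] ∑ (subsetsF (u ∷ ts)) (λ Ss → φ (S ∷ Ss))
    ≡⟨ ∑-cong (subsets t) (λ S → ∑-subsetsF u ts _) ⟩
  ∑[ S ∈ subsets t ] ∑[ U ∈ subsets u ] ∑[ Ss ∈ subsetsF ts ] φ (S ∷ U ∷ Ss)
    ≡⟨ ∑-comm (subsets t) (subsets u) _ ⟩
  ∑[ U ∈ subsets u ] ∑[ S ∈ subsets t ] ∑[ Ss ∈ subsetsF ts ] φ (S ∷ U ∷ Ss)
    ≡⟨ ∑-cong (subsets u) (λ U → ∑-cong (subsets t) (λ S → ∑-cong (subsetsF ts) (φ-swap S U))) ⟩
  ∑[ U ∈ subsets u ] ∑[ S ∈ subsets t ] ∑[ Ss ∈ subsetsF ts ] φ (U ∷ S ∷ Ss)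
    ≡⟨ ∑-cong (subsets u) (λ U → ∑-subsetsF t ts _) ⟨
  ∑[ U ∈ subsets u ] ∑ (subsetsF (t ∷ ts)) (λ Ss → φ (U ∷ Ss))
    ≡⟨ ∑-subsetsF u (t ∷ ts) φ ⟨
  countF p (u ∷ t ∷ ts) i ∎
  where
  φ : List LTree → ℕ
  φ Ss = 𝟙 (all p Ss ∧ (sizeF Ss ≡ᵇ i))
  φ-swap : ∀ S U Ss → φ (S ∷ U ∷ Ss) ≡ φ (U ∷ S ∷ Ss)
  φ-swap S U Ss = cong₂ (λ b n → 𝟙 (b ∧ (n ≡ᵇ i)))
    (𝔹∧.x∙yz≈y∙xz (p S) (p U) (all p Ss)) (ℕ+.x∙yz≈y∙xz (size S) (size U) (sizeF Ss))

countF-∷ʳ : ∀ p ts t → countF p (ts ∷ʳ t) ≗ conv (count p t) (countF p ts)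
countF-∷ʳ p []       t i = countF-∷ p t [] i
countF-∷ʳ p (u ∷ ts) t i = begin
  countF p (u ∷ (ts ∷ʳ t)) i
    ≡⟨ countF-∷ p u (ts ∷ʳ t) i ⟩
  conv (count p u) (countF p (ts ∷ʳ t)) i
    ≡⟨ conv-cong {f = count p u} (λ _ → refl) (λ j → trans (countF-∷ʳ p ts t j) (sym (countF-∷ p t ts j))) i ⟩
  conv (count p u) (countF p (t ∷ ts)) i
    ≡⟨ countF-∷ p u (t ∷ ts) i ⟨
  countF p (u ∷ t ∷ ts) i
    ≡⟨ countF-swap p u t ts i ⟩
  countF p (t ∷ u ∷ ts) i
    ≡⟨ countF-∷ p t (u ∷ ts) i ⟩
  conv (count p t) (countF p (u ∷ ts)) i ∎

all-independent : ∀ Ss → independentF Ss ≡ all independent Ss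
all-independent []       = refl
all-independent (S ∷ Ss) = cong (independent S ∧_) (all-independent Ss)

all-avoidsRoot : ∀ Ss → (noRootIn Ss ∧ independentF Ss) ≡ all avoidsRoot Ss
all-avoidsRoot []                       = refl
all-avoidsRoot (lnode true  _ ∷ Ss)     = refl
all-avoidsRoot (S@(lnode false _) ∷ Ss) =
  trans (𝔹∧.x∙yz≈y∙xz (noRootIn Ss) (independent S) (independentF Ss))
        (cong (independent S ∧_) (all-avoidsRoot Ss))

count-node-independent : ∀ ts i →
  count independent (node ts) i ≡ countF independent ts i + shift (countF avoidsRoot ts) i
count-node-independent ts i = begin
  count independent (node ts) i
    ≡⟨ ∑-subsets ts _ ⟩
  with-root i + without-root
    ≡⟨ +-comm (with-root i) without-root ⟩
  without-root + with-root i
    ≡⟨ cong₂ _+_ (∑-cong (subsetsF ts) (λ Ss → cong (λ b → 𝟙 (b ∧ (sizeF Ss ≡ᵇ i))) (all-independent Ss)))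
                 (with-root≡ i) ⟩
  countF independent ts i + shift (countF avoidsRoot ts) i ∎
  where
  with-root : ℕ → ℕ
  with-root i = ∑[ Ss ∈ subsetsF ts ] 𝟙 ((noRootIn Ss ∧ independentF Ss) ∧ (suc (sizeF Ss) ≡ᵇ i))
  without-root : ℕ
  without-root = ∑[ Ss ∈ subsetsF ts ] 𝟙 (independentF Ss ∧ (sizeF Ss ≡ᵇ i))
  with-root≡ : ∀ i → with-root i ≡ shift (countF avoidsRoot ts) i
  with-root≡ zero    = ∑-zero (subsetsF ts) (λ _ → cong 𝟙 (∧-zeroʳ _))
  with-root≡ (suc i) = ∑-cong (subsetsF ts) (λ Ss → cong (λ b → 𝟙 (b ∧ (sizeF Ss ≡ᵇ i))) (all-avoidsRoot Ss))

count-node-avoidsRoot : ∀ ts → count avoidsRoot (node ts) ≗ countF independent ts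
count-node-avoidsRoot ts i = trans (∑-subsets ts _)
  (cong₂ _+_ (∑-zero (subsetsF ts) (λ _ → refl))
             (∑-cong (subsetsF ts) (λ Ss → cong (λ b → 𝟙 (b ∧ (sizeF Ss ≡ᵇ i))) (all-independent Ss))))

mutual
  indepPoly : Tree → ℕ → ℕ
  indepPoly (node ts) i = indepPolyF ts i + shift (indepPolyF⁻ ts) i

  indepPolyF : List Tree → ℕ → ℕ
  indepPolyF []       = one
  indepPolyF (t ∷ ts) = conv (indepPoly t) (indepPolyF ts)

  -- the independence polynomial of the forest ts with all its roots deleted
  indepPolyF⁻ : List Tree → ℕ → ℕ
  indepPolyF⁻ []            = one
  indepPolyF⁻ (node us ∷ ts) = conv (indepPolyF us) (indepPolyF⁻ ts)

mutual
  count-independent : ∀ t → count independent t ≗ indepPoly t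
  count-independent (node ts) i =
    trans (count-node-independent ts i)
          (cong₂ _+_ (countF-independent ts i) (shift-cong (countF-avoidsRoot ts) i))

  countF-independent : ∀ ts → countF independent ts ≗ indepPolyF ts
  countF-independent []       = countF-[] independent
  countF-independent (t ∷ ts) i =
    trans (countF-∷ independent t ts i) (conv-cong (count-independent t) (countF-independent ts) i)

  countF-avoidsRoot : ∀ ts → countF avoidsRoot ts ≗ indepPolyF⁻ ts
  countF-avoidsRoot []             = countF-[] avoidsRoot
  countF-avoidsRoot (node us ∷ ts) i =
    trans (countF-∷ avoidsRoot (node us) ts i) (conv-cong (count-avoidsRoot us) (countF-avoidsRoot ts) i)

  count-avoidsRoot : ∀ us → count avoidsRoot (node us) ≗ indepPolyF us
  count-avoidsRoot us i = trans (count-node-avoidsRoot us i) (countF-independent us i)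

indepCoeff≡indepPoly : ∀ t → indepCoeff t ≗ indepPoly t
indepCoeff≡indepPoly t i =
  trans (length-filterᵇ (λ S → independent S ∧ (size S ≡ᵇ i)) (subsets t)) (count-independent t i)

indepPolyF-∷ʳ : ∀ ts t → indepPolyF (ts ∷ʳ t) ≗ conv (indepPoly t) (indepPolyF ts)
indepPolyF-∷ʳ ts t i = begin
  indepPolyF (ts ∷ʳ t) i                              ≡⟨ countF-independent (ts ∷ʳ t) i ⟨
  countF independent (ts ∷ʳ t) i                      ≡⟨ countF-∷ʳ independent ts t i ⟩
  conv (count independent t) (countF independent ts) i
    ≡⟨ conv-cong (count-independent t) (countF-independent ts) i ⟩
  conv (indepPoly t) (indepPolyF ts) i                ∎

indepPolyF⁻-∷ʳ : ∀ ts us → indepPolyF⁻ (ts ∷ʳ node us) ≗ conv (indepPolyF us) (indepPolyF⁻ ts)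
indepPolyF⁻-∷ʳ ts us i = begin
  indepPolyF⁻ (ts ∷ʳ node us) i                       ≡⟨ countF-avoidsRoot (ts ∷ʳ node us) i ⟨
  countF avoidsRoot (ts ∷ʳ node us) i                 ≡⟨ countF-∷ʳ avoidsRoot ts (node us) i ⟩
  conv (count avoidsRoot (node us)) (countF avoidsRoot ts) i
    ≡⟨ conv-cong (count-avoidsRoot us) (countF-avoidsRoot ts) i ⟩
  conv (indepPolyF us) (indepPolyF⁻ ts) i             ∎

Deg≤ : (ℕ → ℕ) → ℕ → Set
Deg≤ f d = ∀ j → d < j → f j ≡ 0

Deg≤-one : Deg≤ one 0
Deg≤-one (suc j) _ = refl

Deg≤-mono : ∀ {f d d′} → d ≤ d′ → Deg≤ f d → Deg≤ f d′
Deg≤-mono d≤d′ f-deg j d′<j = f-deg j (≤-<-trans d≤d′ d′<j)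

Deg≤-+ : ∀ {f g d} → Deg≤ f d → Deg≤ g d → Deg≤ (λ j → f j + g j) d
Deg≤-+ f-deg g-deg j d<j = cong₂ _+_ (f-deg j d<j) (g-deg j d<j)

Deg≤-shift : ∀ {f d} → Deg≤ f d → Deg≤ (shift f) (suc d)
Deg≤-shift f-deg (suc j) d<j = f-deg j (≤-pred d<j)

Deg≤-conv : ∀ {f g a b} → Deg≤ f a → Deg≤ g b → Deg≤ (conv f g) (a + b)
Deg≤-conv {f} {g} {a} {b} f-deg g-deg j a+b<j = ∑<-zero (suc j) term≡0
  where
  term≡0 : ∀ k → k < suc j → f k * g (j ∸ k) ≡ 0
  term≡0 k _ with a <? k
  ... | yes a<k = cong (_* g (j ∸ k)) (f-deg k a<k)
  ... | no  a≮k = trans (cong (f k *_) (g-deg (j ∸ k) b<j∸k)) (*-zeroʳ (f k))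
    where
    b<j∸k : b < j ∸ k
    b<j∸k = m+n≤o⇒m≤o∸n (suc b)
      (subst (_≤ j) (cong suc (+-comm k b)) (≤-<-trans (+-monoˡ-≤ b (≮⇒≥ a≮k)) a+b<j))

Deg≤-cong : ∀ {f g d} → f ≗ g → Deg≤ f d → Deg≤ g d
Deg≤-cong f≗g f-deg j d<j = trans (sym (f≗g j)) (f-deg j d<j)

-- α t is the independence number of t; αF and αF⁻ are the same for the forests of indepPolyF and indepPolyF⁻.
mutual
  α : Tree → ℕ
  α (node ts) = αF ts ⊔ suc (αF⁻ ts)

  αF : List Tree → ℕ
  αF []       = 0
  αF (t ∷ ts) = α t + αF ts

  αF⁻ : List Tree → ℕ
  αF⁻ []             = 0
  αF⁻ (node us ∷ ts) = αF us + αF⁻ ts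

mutual
  indepPoly-deg : ∀ t → Deg≤ (indepPoly t) (α t)
  indepPoly-deg (node ts) =
    Deg≤-+ (Deg≤-mono (m≤m⊔n (αF ts) _) (indepPolyF-deg ts))
           (Deg≤-mono (m≤n⊔m (αF ts) _) (Deg≤-shift (indepPolyF⁻-deg ts)))

  indepPolyF-deg : ∀ ts → Deg≤ (indepPolyF ts) (αF ts)
  indepPolyF-deg []       = Deg≤-one
  indepPolyF-deg (t ∷ ts) = Deg≤-conv (indepPoly-deg t) (indepPolyF-deg ts)

  indepPolyF⁻-deg : ∀ ts → Deg≤ (indepPolyF⁻ ts) (αF⁻ ts)
  indepPolyF⁻-deg []             = Deg≤-one
  indepPolyF⁻-deg (node us ∷ ts) = Deg≤-conv (indepPolyF-deg us) (indepPolyF⁻-deg ts)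

conv-top : ∀ {f g} e k D → Deg≤ f (e + k) → Deg≤ g (k + D) →
  conv f g (e + (k + D)) ≡ ∑[ t < suc k ] f (e + t) * g (k + D ∸ t)
conv-top {f} {g} e k D f-deg g-deg = begin
  conv f g (e + (k + D))
    ≡⟨⟩
  ∑< (suc (e + (k + D))) h
    ≡⟨ cong (λ n → ∑< n h) (+-suc e (k + D)) ⟨
  ∑< (e + (suc k + D)) h
    ≡⟨ ∑<-split e (suc k + D) h ⟩
  ∑< e h + (∑[ t < suc k + D ] h (e + t))
    ≡⟨ cong₂ _+_ (∑<-zero e below) (∑<-split (suc k) D (λ t → h (e + t))) ⟩
  (∑[ t < suc k ] h (e + t)) + (∑[ u < D ] h (e + (suc k + u)))
    ≡⟨ cong₂ _+_ (∑<-cong (suc k) (λ t _ → window t)) (∑<-zero D above) ⟩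
  (∑[ t < suc k ] f (e + t) * g (k + D ∸ t)) + 0
    ≡⟨ +-identityʳ _ ⟩
  ∑[ t < suc k ] f (e + t) * g (k + D ∸ t) ∎
  where
  h : ℕ → ℕ
  h j = f j * g (e + (k + D) ∸ j)
  below : ∀ j → j < e → h j ≡ 0
  below j j<e = trans (cong (f j *_) (g-deg _ k+D<)) (*-zeroʳ (f j))
    where
    k+D< : k + D < e + (k + D) ∸ j
    k+D< = subst (_< e + (k + D) ∸ j) (m+n∸m≡n j (k + D))
                 (∸-monoˡ-< (+-monoˡ-< (k + D) j<e) (m≤m+n j (k + D)))
  window : ∀ t → h (e + t) ≡ f (e + t) * g (k + D ∸ t)
  window t = cong (λ n → f (e + t) * g n) ([m+n]∸[m+o]≡n∸o e (k + D) t)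
  above : ∀ u → u < D → h (e + (suc k + u)) ≡ 0
  above u _ = cong (_* _) (f-deg _ (+-monoʳ-< e (s≤s (m≤m+n k u))))

-- rev d f k is the coefficient of x^(d ∸ k); it is meaningful only for k ≤ d.
rev : ℕ → (ℕ → ℕ) → ℕ → ℕ
rev d f k = f (d ∸ k)

conv-rev : ∀ {f g a b k} → Deg≤ f a → Deg≤ g b → k ≤ a → k ≤ b →
  rev (a + b) (conv f g) k ≡ conv (rev b g) (rev a f) k
conv-rev {f} {g} {k = k} f-deg g-deg k≤a k≤b
  with e , refl ← m≤n⇒∃[o]m+o≡n k≤a | D , refl ← m≤n⇒∃[o]m+o≡n k≤b = begin
  conv f g (k + e + (k + D) ∸ k)
    ≡⟨ cong (conv f g) (trans (cong (_∸ k) (+-assoc k e (k + D))) (m+n∸m≡n k (e + (k + D)))) ⟩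
  conv f g (e + (k + D))
    ≡⟨ conv-top e k D (subst (Deg≤ f) (+-comm k e) f-deg) g-deg ⟩
  ∑[ t < suc k ] f (e + t) * g (k + D ∸ t)
    ≡⟨ ∑<-cong (suc k) (λ t t<1+k → reflect t (≤-pred t<1+k)) ⟩
  conv (rev (k + D) g) (rev (k + e) f) k ∎
  where
  k+e∸[k∸t] : ∀ t → t ≤ k → k + e ∸ (k ∸ t) ≡ e + t
  k+e∸[k∸t] t t≤k = trans (+-∸-comm e (m∸n≤m k t)) (trans (cong (_+ e) (m∸[m∸n]≡n t≤k)) (+-comm t e))
  reflect : ∀ t → t ≤ k → f (e + t) * g (k + D ∸ t) ≡ g (k + D ∸ t) * f (k + e ∸ (k ∸ t))
  reflect t t≤k = trans (*-comm (f (e + t)) _) (cong (λ i → g (k + D ∸ t) * f i) (sym (k+e∸[k∸t] t t≤k)))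

module PowerTopCoefficients
  {P : ℕ → ℕ} {n : ℕ} (P-deg : Deg≤ P n) (2≤n : 2 ≤ n)
  {a : ℕ → ℕ → ℕ} {d : ℕ} (a₀-deg : Deg≤ (a 0) d) (2≤d : 2 ≤ d)
  (a-step : ∀ m → a (suc m) ≗ conv P (a m))
  where

  top : ℕ → ℕ
  top zero    = d
  top (suc m) = n + top m

  top≡ : ∀ m → top m ≡ n * m + d
  top≡ zero    = cong (_+ d) (sym (*-zeroʳ n))
  top≡ (suc m) = begin
    n + top m         ≡⟨ cong (n +_) (top≡ m) ⟩
    n + (n * m + d)   ≡⟨ +-assoc n (n * m) d ⟨
    n + n * m + d     ≡⟨ cong (_+ d) (*-suc n m) ⟨
    n * suc m + d     ∎

  deg : ∀ m → Deg≤ (a m) (top m)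
  deg zero    = a₀-deg
  deg (suc m) = Deg≤-cong (λ i → sym (a-step m i)) (Deg≤-conv P-deg (deg m))

  d≤top : ∀ m → d ≤ top m
  d≤top zero    = ≤-refl
  d≤top (suc m) = ≤-trans (d≤top m) (m≤n+m (top m) n)

  rev-step : ∀ m k → k ≤ 2 → rev (top (suc m)) (a (suc m)) k ≡ conv (rev (top m) (a m)) (rev n P) k
  rev-step m k k≤2 = trans (a-step m _)
    (conv-rev P-deg (deg m) (≤-trans k≤2 2≤n) (≤-trans k≤2 (≤-trans 2≤d (d≤top m))))

C2-suc : ∀ m → suc m C 2 ≡ m + m C 2
C2-suc m = trans (sym (nCk+nC[k+1]≡[n+1]C[k+1] m 1)) (cong (_+ m C 2) (nC1≡n m))

-- The first three coefficients of r m = r 0 · ρᵐ for a series ρ with constant term 1.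
module TruncatedPowers
  {ρ : ℕ → ℕ} {r : ℕ → ℕ → ℕ} (ρ₀≡1 : ρ 0 ≡ 1)
  (r-step : ∀ m k → k ≤ 2 → r (suc m) k ≡ conv (r m) ρ k)
  where

  r₀ : ∀ m → r m 0 ≡ r 0 0
  r₀ zero    = refl
  r₀ (suc m) = begin
    r (suc m) 0   ≡⟨ r-step m 0 z≤n ⟩
    r m 0 * ρ 0   ≡⟨ cong₂ _*_ (r₀ m) ρ₀≡1 ⟩
    r 0 0 * 1     ≡⟨ *-identityʳ _ ⟩
    r 0 0         ∎

  r₁ : ∀ m → r m 1 ≡ r 0 1 + m * (r 0 0 * ρ 1)
  r₁ zero    = sym (+-identityʳ _)
  r₁ (suc m) = begin
    r (suc m) 1
      ≡⟨ r-step m 1 (s≤s z≤n) ⟩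
    r m 0 * ρ 1 + r m 1 * ρ 0
      ≡⟨ cong₂ (λ x y → x * ρ 1 + y) (r₀ m) (cong₂ _*_ (r₁ m) ρ₀≡1) ⟩
    r 0 0 * ρ 1 + (r 0 1 + m * (r 0 0 * ρ 1)) * 1
      ≡⟨ identity m (r 0 0) (r 0 1) (ρ 1) ⟩
    r 0 1 + suc m * (r 0 0 * ρ 1) ∎
    where
    identity : ∀ m x₀ x₁ ρ₁ → x₀ * ρ₁ + (x₁ + m * (x₀ * ρ₁)) * 1 ≡ x₁ + suc m * (x₀ * ρ₁)
    identity = solve-∀

  r₂ : ∀ m → r m 2 ≡ r 0 2 + m * (r 0 0 * ρ 2 + r 0 1 * ρ 1) + (m C 2) * (r 0 0 * ρ 1 * ρ 1)
  r₂ zero    = sym (trans (+-identityʳ _) (+-identityʳ _))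
  r₂ (suc m) = begin
    r (suc m) 2
      ≡⟨ r-step m 2 ≤-refl ⟩
    r m 0 * ρ 2 + r m 1 * ρ 1 + r m 2 * ρ 0
      ≡⟨ cong₂ (λ x y → x * ρ 2 + y * ρ 1 + r m 2 * ρ 0) (r₀ m) (r₁ m) ⟩
    r 0 0 * ρ 2 + (r 0 1 + m * (r 0 0 * ρ 1)) * ρ 1 + r m 2 * ρ 0
      ≡⟨ cong (r 0 0 * ρ 2 + (r 0 1 + m * (r 0 0 * ρ 1)) * ρ 1 +_) (cong₂ _*_ (r₂ m) ρ₀≡1) ⟩
    r 0 0 * ρ 2 + (r 0 1 + m * (r 0 0 * ρ 1)) * ρ 1
      + (r 0 2 + m * (r 0 0 * ρ 2 + r 0 1 * ρ 1) + (m C 2) * (r 0 0 * ρ 1 * ρ 1)) * 1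
      ≡⟨ identity m (m C 2) (r 0 0) (r 0 1) (r 0 2) (ρ 1) (ρ 2) ⟩
    r 0 2 + suc m * (r 0 0 * ρ 2 + r 0 1 * ρ 1) + (m + m C 2) * (r 0 0 * ρ 1 * ρ 1)
      ≡⟨ cong (λ c → r 0 2 + suc m * (r 0 0 * ρ 2 + r 0 1 * ρ 1) + c * (r 0 0 * ρ 1 * ρ 1)) (C2-suc m) ⟨
    r 0 2 + suc m * (r 0 0 * ρ 2 + r 0 1 * ρ 1) + (suc m C 2) * (r 0 0 * ρ 1 * ρ 1) ∎
    where
    identity : ∀ m c x₀ x₁ x₂ ρ₁ ρ₂ →
      x₀ * ρ₂ + (x₁ + m * (x₀ * ρ₁)) * ρ₁ + (x₂ + m * (x₀ * ρ₂ + x₁ * ρ₁) + c * (x₀ * ρ₁ * ρ₁)) * 1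
      ≡ x₂ + suc m * (x₀ * ρ₂ + x₁ * ρ₁) + (m + c) * (x₀ * ρ₁ * ρ₁)
    identity = solve-∀

C2-double : ∀ m → (m C 2) * 2 + m ≡ m * m
C2-double zero    = refl
C2-double (suc m) = begin
  (suc m C 2) * 2 + suc m          ≡⟨ cong (λ c → c * 2 + suc m) (C2-suc m) ⟩
  (m + m C 2) * 2 + suc m          ≡⟨ regroup m (m C 2) ⟩
  (m C 2) * 2 + m + suc (m + m)    ≡⟨ cong (_+ suc (m + m)) (C2-double m) ⟩
  m * m + suc (m + m)              ≡⟨ square-suc m ⟩
  suc m * suc m                    ∎
  where
  regroup : ∀ m c → (m + c) * 2 + suc m ≡ c * 2 + m + suc (m + m)
  regroup = solve-∀
  square-suc : ∀ m → m * m + suc (m + m) ≡ suc m * suc m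
  square-suc = solve-∀

-- Adding 5hm to both sides eliminates c; writing m = m₀ + n, both sides become quadratics in n,
-- and the three hypotheses compare their coefficients.
quadratic-comparison : ∀ p₀ p₁ q₀ q₁ h m₀ m c → m₀ ≤ m → c * 2 + m ≡ m * m →
  (p₀ + p₁ * m₀) * (p₀ + p₁ * m₀) + 5 * h * m₀ < 5 * (q₀ + q₁ * m₀ + h * (m₀ * m₀)) →
  2 * (p₀ + p₁ * m₀) * p₁ + 5 * h ≤ 5 * q₁ + 10 * h * m₀ →
  p₁ * p₁ ≤ 5 * h →
  (p₀ + p₁ * m) * (p₀ + p₁ * m) < (q₀ + q₁ * m + h * 2 * c) * 5
quadratic-comparison p₀ p₁ q₀ q₁ h m₀ m c m₀≤m 2c+m≡m² n⁰-coeff n¹-coeff n²-coeff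
  with n , refl ← m≤n⇒∃[o]m+o≡n m₀≤m =
  +-cancelʳ-< (5 * h * (m₀ + n)) _ _ (subst₂ _<_ (sym (lhs-expand p₀ p₁ h m₀ n)) (sym rhs-expand)
    (+-mono-<-≤ (+-mono-<-≤ n⁰-coeff (*-monoˡ-≤ n n¹-coeff)) (*-monoˡ-≤ (n * n) n²-coeff)))
  where
  lhs-expand : ∀ p₀ p₁ h m₀ n →
    (p₀ + p₁ * (m₀ + n)) * (p₀ + p₁ * (m₀ + n)) + 5 * h * (m₀ + n)
    ≡ ((p₀ + p₁ * m₀) * (p₀ + p₁ * m₀) + 5 * h * m₀) + (2 * (p₀ + p₁ * m₀) * p₁ + 5 * h) * n
      + p₁ * p₁ * (n * n)
  lhs-expand = solve-∀
  rhs-expand : (q₀ + q₁ * (m₀ + n) + h * 2 * c) * 5 + 5 * h * (m₀ + n)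
               ≡ 5 * (q₀ + q₁ * m₀ + h * (m₀ * m₀)) + (5 * q₁ + 10 * h * m₀) * n + 5 * h * (n * n)
  rhs-expand = begin
    (q₀ + q₁ * (m₀ + n) + h * 2 * c) * 5 + 5 * h * (m₀ + n)
      ≡⟨ eliminate q₀ q₁ h (m₀ + n) c ⟩
    5 * q₀ + 5 * q₁ * (m₀ + n) + 5 * h * (c * 2 + (m₀ + n))
      ≡⟨ cong (λ x → 5 * q₀ + 5 * q₁ * (m₀ + n) + 5 * h * x) 2c+m≡m² ⟩
    5 * q₀ + 5 * q₁ * (m₀ + n) + 5 * h * ((m₀ + n) * (m₀ + n))
      ≡⟨ shift-origin q₀ q₁ h m₀ n ⟩
    5 * (q₀ + q₁ * m₀ + h * (m₀ * m₀)) + (5 * q₁ + 10 * h * m₀) * n + 5 * h * (n * n) ∎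
    where
    eliminate : ∀ q₀ q₁ h m c →
      (q₀ + q₁ * m + h * 2 * c) * 5 + 5 * h * m ≡ 5 * q₀ + 5 * q₁ * m + 5 * h * (c * 2 + m)
    eliminate = solve-∀
    shift-origin : ∀ q₀ q₁ h m₀ n →
      5 * q₀ + 5 * q₁ * (m₀ + n) + 5 * h * ((m₀ + n) * (m₀ + n))
      ≡ 5 * (q₀ + q₁ * m₀ + h * (m₀ * m₀)) + (5 * q₁ + 10 * h * m₀) * n + 5 * h * (n * n)
    shift-origin = solve-∀

branch : Tree
branch = Z 2 (S₂ 4)

rootChildren : ℕ → List Tree
rootChildren zero    = Z 2 P₂ ∷ []
rootChildren (suc m) = rootChildren m ∷ʳ branch

G : ℕ → Tree
G m = attachIter (T₁ 2) (S₂ 4) 2 m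

G≡node : ∀ m → G m ≡ node (rootChildren m)
G≡node zero    = refl
G≡node (suc m) = cong (λ t → attach t (S₂ 4) 2) (G≡node m)

-- indepPolyF (rootChildren m) and indepPolyF⁻ (rootChildren m) are I(G m − v) and I(G m − N[v]).
module G-v = PowerTopCoefficients (indepPoly-deg branch) (s≤s (s≤s z≤n))
  {a = λ m → indepPolyF (rootChildren m)} (indepPolyF-deg (rootChildren 0)) (s≤s (s≤s z≤n))
  (λ m → indepPolyF-∷ʳ (rootChildren m) branch)

module G-N[v] = PowerTopCoefficients (indepPolyF-deg (S₂ 4 ∷ S₂ 4 ∷ [])) (s≤s (s≤s z≤n))
  {a = λ m → indepPolyF⁻ (rootChildren m)} (indepPolyF⁻-deg (rootChildren 0)) (s≤s (s≤s z≤n))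
  (λ m → indepPolyF⁻-∷ʳ (rootChildren m) (S₂ 4 ∷ S₂ 4 ∷ []))

module G-v-top = TruncatedPowers {rev (α branch) (indepPoly branch)}
  {λ m → rev (G-v.top m) (indepPolyF (rootChildren m))} refl G-v.rev-step
module G-N[v]-top = TruncatedPowers {rev (αF (S₂ 4 ∷ S₂ 4 ∷ [])) (indepPolyF (S₂ 4 ∷ S₂ 4 ∷ []))}
  {λ m → rev (G-N[v].top m) (indepPolyF⁻ (rootChildren m))} refl G-N[v].rev-step

indepCoeff-G : ∀ m i →
  indepCoeff (G m) i ≡ indepPolyF (rootChildren m) i + shift (indepPolyF⁻ (rootChildren m)) i
indepCoeff-G m i = trans (indepCoeff≡indepPoly (G m) i) (cong (λ t → indepPoly t i) (G≡node m))

rev-at : ∀ (f : ℕ → ℕ) {d} x c {k} → d ≡ x + c → k ≤ c → rev d f k ≡ f (x + (c ∸ k))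
rev-at f x c refl k≤c = cong f (+-∸-assoc x k≤c)

indepCoeff-G-top : ∀ m k → k ≤ 2 → indepCoeff (G m) (10 * m + (3 ∸ k))
  ≡ rev (G-v.top m) (indepPolyF (rootChildren m)) k + rev (G-N[v].top m) (indepPolyF⁻ (rootChildren m)) k
indepCoeff-G-top m k k≤2 = begin
  indepCoeff (G m) (10 * m + (3 ∸ k))
    ≡⟨ indepCoeff-G m _ ⟩
  a (10 * m + (3 ∸ k)) + shift b (10 * m + (3 ∸ k))
    ≡⟨ cong (λ i → a (10 * m + (3 ∸ k)) + shift b i) index ⟩
  a (10 * m + (3 ∸ k)) + b (10 * m + (2 ∸ k))
    ≡⟨ cong₂ _+_ (rev-at a (10 * m) 3 (G-v.top≡ m) (≤-trans k≤2 (n≤1+n 2)))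
                 (rev-at b (10 * m) 2 (G-N[v].top≡ m) k≤2) ⟨
  rev (G-v.top m) a k + rev (G-N[v].top m) b k ∎
  where
  a b : ℕ → ℕ
  a = indepPolyF (rootChildren m)
  b = indepPolyF⁻ (rootChildren m)
  index : 10 * m + (3 ∸ k) ≡ suc (10 * m + (2 ∸ k))
  index = trans (cong (10 * m +_) (+-∸-assoc 1 k≤2)) (+-suc (10 * m) (2 ∸ k))

indepCoeff-G-3 : ∀ m → indepCoeff (G m) (10 * m + 3) ≡ 5
indepCoeff-G-3 m = trans (indepCoeff-G-top m 0 z≤n) (cong₂ _+_ (G-v-top.r₀ m) (G-N[v]-top.r₀ m))

indepCoeff-G-2 : ∀ m → indepCoeff (G m) (10 * m + 2) ≡ (6 + m * 296) + (4 + m * 160)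
indepCoeff-G-2 m = trans (indepCoeff-G-top m 1 (s≤s z≤n)) (cong₂ _+_ (G-v-top.r₁ m) (G-N[v]-top.r₁ m))

indepCoeff-G-1 : ∀ m → indepCoeff (G m) (10 * m + 1)
  ≡ (5 + m * 3276 + (m C 2) * 87616) + (1 + m * 2064 + (m C 2) * 6400)
indepCoeff-G-1 m = trans (indepCoeff-G-top m 2 ≤-refl) (cong₂ _+_ (G-v-top.r₂ m) (G-N[v]-top.r₂ m))

indepCoeff-G-deg : ∀ m → Deg≤ (indepCoeff (G m)) (10 * m + 3)
indepCoeff-G-deg m = Deg≤-cong (λ i → sym (indepCoeff-G m i))
  (Deg≤-+ (subst (Deg≤ _) (G-v.top≡ m) (G-v.deg m))
          (subst (Deg≤ _) (sym (+-suc (10 * m) 2))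
                 (Deg≤-shift (subst (Deg≤ _) (G-N[v].top≡ m) (G-N[v].deg m)))))

log-concavity-failure : ∀ m → 9 ≤ m →
  ((6 + m * 296) + (4 + m * 160)) * ((6 + m * 296) + (4 + m * 160))
    < ((5 + m * 3276 + (m C 2) * 87616) + (1 + m * 2064 + (m C 2) * 6400)) * 5
log-concavity-failure m 9≤m =
  subst₂ (λ x y → x * x < y * 5)
         (sym (merge₁ m 6 296 4 160)) (sym (merge₂ m (m C 2) 5 3276 87616 1 2064 6400))
    (quadratic-comparison 10 456 6 5340 47008 9 m (m C 2) 9≤m (C2-double m)
      (≤ᵇ⇒≤ _ _ tt) (≤ᵇ⇒≤ _ _ tt) (≤ᵇ⇒≤ _ _ tt))
  where
  merge₁ : ∀ m a₀ a₁ b₀ b₁ → (a₀ + m * a₁) + (b₀ + m * b₁) ≡ (a₀ + b₀) + (a₁ + b₁) * m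
  merge₁ = solve-∀
  merge₂ : ∀ m c a₀ a₁ a₂ b₀ b₁ b₂ →
    (a₀ + m * a₁ + c * a₂) + (b₀ + m * b₁ + c * b₂) ≡ (a₀ + b₀) + (a₁ + b₁) * m + (a₂ + b₂) * c
  merge₂ = solve-∀

corollary4p12 : (m : ℕ) → m ≥ 9 →
    let G = attachIter (T₁ 2) (S₂ 4) 2 m
        s = indepCoeff G
    in (s (10 * m + 3) ≢ 0 × (∀ i → i > 10 * m + 3 → s i ≡ 0))
       × (s (10 * m + 2) * s (10 * m + 2) < s (10 * m + 1) * s (10 * m + 3))
corollary4p12 m 9≤m =
  ((λ s≡0 → contradiction (trans (sym (indepCoeff-G-3 m)) s≡0) λ ()) , indepCoeff-G-deg m) ,
  subst₂ _<_ (sym (cong₂ _*_ (indepCoeff-G-2 m) (indepCoeff-G-2 m)))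
             (sym (cong₂ _*_ (indepCoeff-G-1 m) (indepCoeff-G-3 m)))
             (log-concavity-failure m 9≤m)
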